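{- Let $G$ be a connected graph of order $n\geqslant 3$ which is not a cycle, and let $k$ be a natural number. If $f\in\mathrm{Aut}(G^{\frac{1}{k}})$, then the restriction $f|_{V(G)}$ is an automorphism of $G$.
   Context: Graphs are finite and simple. The $k$-subdivision $G^{\frac{1}{k}}$ of $G$ is obtained by replacing each edge $uv$ of $G$ by a path of length $k$ between $u$ and $v$ (with $k-1$ new internal vertices, distinct for distinct edges); thus $V(G)\subseteq V(G^{\frac{1}{k}})$. -}

module Defs where

open import Data.Nat using (ℕ; zero; suc; _≤_)
open import Data.Fin using (Fin; toℕ; _<_)
open import Data.Bool using (Bool; true; false)
open import Data.Product using (Σ; ∃; _×_; _,_)
open import Data.Sum using (_⊎_)
open import Relation.Binary.PropositionalEquality using (_≡_)
open import Function.Definitions using (Bijective)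
open import Function.Bundles using (_⇔_)

record SimpleGraph (n : ℕ) : Set where
  field
    adj    : Fin n → Fin n → Bool
    sym    : ∀ u v → adj u v ≡ adj v u
    irrefl : ∀ v → adj v v ≡ false

open SimpleGraph public

Adj : ∀ {n} → SimpleGraph n → Fin n → Fin n → Set
Adj G u v = adj G u v ≡ true

data Reachable {n} (G : SimpleGraph n) : Fin n → Fin n → Set where
  here : ∀ {u} → Reachable G u u
  step : ∀ {u w v} → Adj G u w → Reachable G w v → Reachable G u v

Connected : ∀ {n} → SimpleGraph n → Set
Connected {n} G = (u v : Fin n) → Reachable G u v

CycleAdj : (n : ℕ) → Fin n → Fin n → Set
CycleAdj n i j =
    suc (toℕ i) ≡ toℕ j
  ⊎ suc (toℕ j) ≡ toℕ i
  ⊎ (toℕ i ≡ 0 × suc (toℕ j) ≡ n)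
  ⊎ (toℕ j ≡ 0 × suc (toℕ i) ≡ n)

IsCycle : ∀ {n} → SimpleGraph n → Set
IsCycle {n} G =
  Σ (Fin n → Fin n) λ σ →
    Bijective _≡_ _≡_ σ × (∀ u v → Adj G u v ⇔ CycleAdj n (σ u) (σ v))

IsAutomorphism : {V : Set} → (V → V → Set) → (V → V) → Set
IsAutomorphism {V} R f = Bijective _≡_ _≡_ f × (∀ x y → R x y ⇔ R (f x) (f y))

-- Each edge uv of G with u < v is replaced by the path
--   u = x₀, x₁, …, x_{k-1}, x_k = v ;
-- the internal vertex x_{j+1} (j : Fin (k ∸ 1)) is  mid u v _ _ j.
data SubV {n} (G : SimpleGraph n) (k : ℕ) : Set where
  orig : Fin n → SubV G k
  mid  : (u v : Fin n) → u < v → Adj G u v → Fin (k Data.Nat.∸ 1) → SubV G k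

EndAdj : ∀ {n} (k : ℕ) → Fin n → Fin n → Fin n → {m : ℕ} → Fin m → Set
EndAdj k a u v j = (a ≡ u × toℕ j ≡ 0) ⊎ (a ≡ v × suc (suc (toℕ j)) ≡ k)

SubAdj : ∀ {n} (G : SimpleGraph n) (k : ℕ) → SubV G k → SubV G k → Set
SubAdj G k (orig a) (orig b) = k ≡ 1 × Adj G a b
SubAdj G k (orig a) (mid u v _ _ j) = EndAdj k a u v j
SubAdj G k (mid u v _ _ j) (orig a) = EndAdj k a u v j
SubAdj G k (mid u v _ _ j) (mid u' v' _ _ j') =
  u ≡ u' × v ≡ v' × (suc (toℕ j) ≡ toℕ j' ⊎ suc (toℕ j') ≡ toℕ j)

-- For k = 1 the subdivision is G itself. For k ≥ 2, every internal vertex of a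
-- subdivided edge has exactly two neighbours, namely its neighbours on that
-- edge. Since G is connected and not a cycle, some vertex b of G does not have
-- exactly two neighbours, so neither does b in G^{1/k}, and f(b) is original.
-- The path of a subdivided edge ac is the only non-backtracking walk of length
-- k that starts with its first step; automorphisms preserve non-backtracking
-- walks, so if f(a) is original then f(c) is an original vertex adjacent to
-- f(a). Spreading out from b, f maps V(G) into V(G) and preserves adjacency;
-- the same holds for f⁻¹, so the restriction is an automorphism of G.
module Submission where

open import Defs
open import Data.Nat using (ℕ; _≤_)
open import Data.Fin using (Fin)
open import Data.Product using (Σ; _×_)
open import Relation.Binary.PropositionalEquality using (_≡_)
open import Relation.Nullary using (¬_)

open import Axiom.UniquenessOfIdentityProofs using (module Decidable⇒UIP)
import Data.Bool as Bool
open import Data.Empty using (⊥-elim)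
import Data.Fin as F
open import Data.Fin.Properties
  using (any?; all?; ¬∀⟶∃¬; ¬∀⟶∃¬-smallest; pigeonhole; toℕ<n; toℕ-injective; toℕ-inject; toℕ-fromℕ<)
import Data.Fin.Properties as Finₚ
open import Data.Nat using (zero; suc; _+_; _∸_; _<_; z≤n; s≤s; _<?_)
open import Data.Nat.Properties
  using ( ≤-refl; ≤-antisym; ≤-pred; <⇒≤; <⇒≢; ≤∧≢⇒<; ≮⇒≥; <-irrefl; <-irrelevant; <-cmp; <-trans
        ; n<1+n; m<n⇒m<1+n; m<n+m; m+n≤o⇒n≤o; m≤n⇒m<n∨m≡n; m∸n≤m; n∸n≡0; suc-injective; anyUpTo?)
open import Data.Product using (_,_; proj₁; proj₂; ∃)
open import Data.Sum using (_⊎_; inj₁; inj₂; [_,_]; swap) renaming (map to ⊎-map; map₂ to ⊎-map₂)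
open import Function.Base using (_∘_)
open import Function.Bundles using (_⇔_; mk⇔; Equivalence)
open import Relation.Binary.Definitions using (Symmetric; DecidableEquality; tri<; tri≈; tri>)
open import Relation.Binary.PropositionalEquality
  using (_≢_; refl; trans; cong; cong₂; subst; subst₂) renaming (sym to ≡-sym)
open import Relation.Nullary using (Dec; yes; no; ¬?)
open import Relation.Nullary.Decidable using (decidable-stable; _×-dec_; _⊎-dec_; _→-dec_)

m∸n≡1+m∸[1+n] : ∀ {m n} → n < m → m ∸ n ≡ suc (m ∸ suc n)
m∸n≡1+m∸[1+n] {suc m} {zero}  _         = refl
m∸n≡1+m∸[1+n] {suc m} {suc n} (s≤s n<m) = m∸n≡1+m∸[1+n] n<m

module Walks {V : Set} (R : V → V → Set) where

  record IsNonBacktrackingWalk (W : ℕ → V) (ℓ : ℕ) : Set where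
    field
      adjacent : ∀ i → i < ℓ → R (W i) (W (suc i))
      noReturn : ∀ i → 2 + i ≤ ℓ → W (2 + i) ≢ W i

  record IsThread (P : ℕ → V) (ℓ : ℕ) : Set where
    field
      isNonBacktrackingWalk : IsNonBacktrackingWalk P ℓ
      interior : ∀ i y → 2 + i ≤ ℓ → R (P (suc i)) y → y ≡ P i ⊎ y ≡ P (2 + i)
    open IsNonBacktrackingWalk isNonBacktrackingWalk public

  HasTwoNeighbours : V → Set
  HasTwoNeighbours x =
    Σ V λ y → Σ V λ z → y ≢ z × R x y × R x z × (∀ w → R x w → w ≡ y ⊎ w ≡ z)

  otherNeighbour : DecidableEquality V → ∀ {x a} → HasTwoNeighbours x → R x a →
                   Σ V λ b → b ≢ a × R x b × (∀ w → R x w → w ≡ a ⊎ w ≡ b)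
  otherNeighbour _≟_ {x} {a} (y , z , y≢z , xy , xz , only) xa with y ≟ a
  ... | yes refl = z , y≢z ∘ ≡-sym , xz , only
  ... | no y≢a   = y , y≢a , xy , λ w xw → swap (⊎-map₂ (λ w≡z → trans w≡z (≡-sym a≡z)) (only w xw))
    where
    a≡z : a ≡ z
    a≡z = [ (λ a≡y → ⊥-elim (y≢a (≡-sym a≡y))) , (λ a≡z → a≡z) ] (only a xa)

  follows-thread : ∀ {P W ℓ} → IsThread P ℓ → IsNonBacktrackingWalk W ℓ →
                   W 0 ≡ P 0 → W 1 ≡ P 1 → ∀ i → i ≤ ℓ → W i ≡ P i
  follows-thread {P} {W} {ℓ} thread walk W₀ W₁ = agree
    where
    open IsThread thread using (interior)
    open IsNonBacktrackingWalk walk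
    agree : ∀ i → i ≤ ℓ → W i ≡ P i
    agree zero          _  = W₀
    agree (suc zero)    _  = W₁
    agree (suc (suc i)) le
      with interior i (W (2 + i)) le
             (subst (λ x → R x (W (2 + i))) (agree (suc i) (<⇒≤ le)) (adjacent (suc i) le))
    ... | inj₁ back  = ⊥-elim (noReturn i le (trans back (≡-sym (agree i (m+n≤o⇒n≤o 2 le)))))
    ... | inj₂ ahead = ahead

  module _ (R-sym : Symmetric R) where

    thread-hasTwoNeighbours : ∀ {P ℓ} → IsThread P ℓ → ∀ i → 2 + i ≤ ℓ → HasTwoNeighbours (P (suc i))
    thread-hasTwoNeighbours {P} thread i le =
      P i , P (2 + i) , noReturn i le ∘ ≡-sym ,
      R-sym (adjacent i (<⇒≤ le)) , adjacent (suc i) le , λ w → interior i w le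
      where open IsThread thread

    reverse-thread : ∀ {P ℓ} → IsThread P ℓ → IsThread (λ i → P (ℓ ∸ i)) ℓ
    reverse-thread {P} {ℓ} thread = record
      { isNonBacktrackingWalk = record { adjacent = adjacent′ ; noReturn = noReturn′ }
      ; interior              = interior′
      }
      where
      open IsThread thread
      two-back : ∀ i → 2 + i ≤ ℓ → 2 + (ℓ ∸ (2 + i)) ≤ ℓ
      two-back i le = subst (_≤ ℓ) (trans (m∸n≡1+m∸[1+n] (<⇒≤ le)) (cong suc (m∸n≡1+m∸[1+n] le)))
                            (m∸n≤m ℓ i)
      adjacent′ : ∀ i → i < ℓ → R (P (ℓ ∸ i)) (P (ℓ ∸ suc i))
      adjacent′ i i<ℓ rewrite m∸n≡1+m∸[1+n] i<ℓ =
        R-sym (adjacent (ℓ ∸ suc i) (subst (_≤ ℓ) (m∸n≡1+m∸[1+n] i<ℓ) (m∸n≤m ℓ i)))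
      noReturn′ : ∀ i → 2 + i ≤ ℓ → P (ℓ ∸ (2 + i)) ≢ P (ℓ ∸ i)
      noReturn′ i le rewrite m∸n≡1+m∸[1+n] (<⇒≤ le) | m∸n≡1+m∸[1+n] le =
        noReturn (ℓ ∸ (2 + i)) (two-back i le) ∘ ≡-sym
      interior′ : ∀ i y → 2 + i ≤ ℓ → R (P (ℓ ∸ suc i)) y → y ≡ P (ℓ ∸ i) ⊎ y ≡ P (ℓ ∸ (2 + i))
      interior′ i y le r rewrite m∸n≡1+m∸[1+n] (<⇒≤ le) | m∸n≡1+m∸[1+n] le =
        swap (interior (ℓ ∸ (2 + i)) y (two-back i le) r)

module Automorphism {V : Set} {R : V → V → Set} {f : V → V} (aut : IsAutomorphism R f) where
  open Walks R

  injective : ∀ {x y} → f x ≡ f y → x ≡ y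
  injective = proj₁ (proj₁ aut)

  preserves : ∀ {x y} → R x y → R (f x) (f y)
  preserves = Equivalence.to (proj₂ aut _ _)

  reflects : ∀ {x y} → R (f x) (f y) → R x y
  reflects = Equivalence.from (proj₂ aut _ _)

  inverse : V → V
  inverse y = proj₁ (proj₂ (proj₁ aut) y)

  f-inverse : ∀ y → f (inverse y) ≡ y
  f-inverse y = proj₂ (proj₂ (proj₁ aut) y) refl

  inverse-f : ∀ x → inverse (f x) ≡ x
  inverse-f x = injective (f-inverse (f x))

  inverse-isAutomorphism : IsAutomorphism R inverse
  inverse-isAutomorphism =
    ( (λ {x} {y} e → trans (≡-sym (f-inverse x)) (trans (cong f e) (f-inverse y)))
    , λ x → f x , λ { refl → inverse-f x } )
    , λ x y → mk⇔ (λ r → reflects (subst₂ R (≡-sym (f-inverse x)) (≡-sym (f-inverse y)) r))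
                  (λ r → subst₂ R (f-inverse x) (f-inverse y) (preserves r))

  map-nonBacktrackingWalk : ∀ {W ℓ} → IsNonBacktrackingWalk W ℓ → IsNonBacktrackingWalk (f ∘ W) ℓ
  map-nonBacktrackingWalk walk = record
    { adjacent = λ i i<ℓ → preserves (adjacent i i<ℓ)
    ; noReturn = λ i le → noReturn i le ∘ injective
    }
    where open IsNonBacktrackingWalk walk

  map-hasTwoNeighbours : ∀ {x} → HasTwoNeighbours x → HasTwoNeighbours (f x)
  map-hasTwoNeighbours {x} (y , z , y≢z , xy , xz , only) =
    f y , f z , y≢z ∘ injective , preserves xy , preserves xz , λ w r →
      ⊎-map (from-preimage w) (from-preimage w)
        (only (inverse w) (reflects (subst (R (f x)) (≡-sym (f-inverse w)) r)))
    where
    from-preimage : ∀ w {v} → inverse w ≡ v → w ≡ f v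
    from-preimage w e = trans (≡-sym (f-inverse w)) (cong f e)

map⁻¹-hasTwoNeighbours : ∀ {V} {R : V → V → Set} {f x} → IsAutomorphism R f →
                         Walks.HasTwoNeighbours R (f x) → Walks.HasTwoNeighbours R x
map⁻¹-hasTwoNeighbours {R = R} {x = x} aut two =
  subst (Walks.HasTwoNeighbours R) (inverse-f x)
        (Automorphism.map-hasTwoNeighbours inverse-isAutomorphism two)
  where open Automorphism aut

module _ {n} (G : SimpleGraph n) where

  adj-sym : Symmetric (Adj G)
  adj-sym {u} {v} uv = trans (sym G v u) uv

  adj-irreflexive : ∀ {u v} → Adj G u v → u ≢ v
  adj-irreflexive {u} uv refl with trans (≡-sym uv) (irrefl G u)
  ... | ()

  adj-irrelevant : ∀ {u v} (p q : Adj G u v) → p ≡ q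
  adj-irrelevant = Decidable⇒UIP.≡-irrelevant Bool._≟_

  hasTwoNeighbours? : ∀ b → Dec (Walks.HasTwoNeighbours (Adj G) b)
  hasTwoNeighbours? b =
    any? λ y → any? λ z → ¬? (y F.≟ z) ×-dec adj? y ×-dec adj? z ×-dec
      all? λ w → adj? w →-dec (w F.≟ y ⊎-dec w F.≟ z)
    where
    adj? : ∀ v → Dec (Adj G b v)
    adj? v = adj G b v Bool.≟ Bool.true

-- CycleAdj n i j unfolds to CyclicallyAdjacent n (toℕ i) (toℕ j).
CyclicallyAdjacent : ℕ → ℕ → ℕ → Set
CyclicallyAdjacent N a b =
  suc a ≡ b ⊎ suc b ≡ a ⊎ (a ≡ 0 × suc b ≡ N) ⊎ (b ≡ 0 × suc a ≡ N)

-- Walk from vertex 0 without backtracking. If p is the first index at which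
-- the walk repeats a vertex, the repeated vertex is the start, and by
-- connectedness walk 0, …, walk (p - 1) lists every vertex exactly once; so
-- p = n and i ↦ walk i is an isomorphism from C_n to G.
module TwoRegular {m} (G : SimpleGraph (suc m)) (connected : Connected G)
                  (two : ∀ v → Walks.HasTwoNeighbours (Adj G) v) where
  open Walks (Adj G)

  Arc : Set
  Arc = Σ (Fin (suc m) × Fin (suc m)) λ e → Adj G (proj₁ e) (proj₂ e)

  advance : Arc → Arc
  advance ((a , b) , ab) = (b , proj₁ next) , proj₁ (proj₂ (proj₂ next))
    where next = otherNeighbour F._≟_ (two b) (adj-sym G ab)

  arc : ℕ → Arc
  arc zero    = (F.zero , proj₁ (two F.zero)) , proj₁ (proj₂ (proj₂ (proj₂ (two F.zero))))
  arc (suc i) = advance (arc i)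

  walk : ℕ → Fin (suc m)
  walk i = proj₁ (proj₁ (arc i))

  walk-adjacent : ∀ i → Adj G (walk i) (walk (suc i))
  walk-adjacent i = proj₂ (arc i)

  walk-noReturn : ∀ i → walk (2 + i) ≢ walk i
  walk-noReturn i = proj₁ (proj₂ (otherNeighbour F._≟_ (two (walk (suc i))) (adj-sym G (walk-adjacent i))))

  walk-interior : ∀ i y → Adj G (walk (suc i)) y → y ≡ walk i ⊎ y ≡ walk (2 + i)
  walk-interior i =
    proj₂ (proj₂ (proj₂ (otherNeighbour F._≟_ (two (walk (suc i))) (adj-sym G (walk-adjacent i)))))

  Repeats : ℕ → Set
  Repeats j = ∃ λ i → i < j × walk i ≡ walk j

  repeats? : ∀ j → Dec (Repeats j)
  repeats? j = anyUpTo? (λ i → walk i F.≟ walk j) j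

  first-repeat : Σ ℕ λ p → Repeats p × (∀ j → j < p → ¬ Repeats j)
  first-repeat
    with i , j , i<j , same ← pigeonhole (n<1+n (suc m)) (walk ∘ F.toℕ)
    with p , ¬¬repeat , before ← ¬∀⟶∃¬-smallest _ (¬_ ∘ Repeats ∘ F.toℕ) (¬? ∘ repeats? ∘ F.toℕ)
                                   (λ none → none j (F.toℕ i , i<j , same))
    = F.toℕ p , decidable-stable (repeats? (F.toℕ p)) ¬¬repeat , λ j j<p →
        subst (¬_ ∘ Repeats) (trans (toℕ-inject (F.fromℕ< j<p)) (toℕ-fromℕ< j<p)) (before (F.fromℕ< j<p))

  module FirstReturn (p′ : ℕ) (repeat : Repeats (suc p′)) (before : ∀ j → j < suc p′ → ¬ Repeats j) where

    p : ℕ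
    p = suc p′

    injective : ∀ {a b} → a < p → b < p → walk a ≡ walk b → a ≡ b
    injective {a} {b} a<p b<p e with <-cmp a b
    ... | tri< a<b _ _ = ⊥-elim (before b b<p (a , a<b , e))
    ... | tri≈ _ a≡b _ = a≡b
    ... | tri> _ _ b<a = ⊥-elim (before a a<p (b , b<a , ≡-sym e))

    1<p : 1 < p
    1<p = ≤∧≢⇒< (s≤s z≤n) λ 1≡p → no-repeat-at-1 (subst Repeats (≡-sym 1≡p) repeat)
      where
      no-repeat-at-1 : ¬ Repeats 1
      no-repeat-at-1 (zero  , _      , e) = adj-irreflexive G (walk-adjacent 0) e
      no-repeat-at-1 (suc _ , s≤s () , _)

    repeats-start : Repeats p → walk p ≡ walk 0
    repeats-start (zero  , _         , e) = ≡-sym e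
    repeats-start (suc i , s≤s i<p′ , e)
      with walk-interior i (walk p′)
             (subst (λ x → Adj G x (walk p′)) (≡-sym e) (adj-sym G (walk-adjacent p′)))
    ... | inj₁ e′ = ⊥-elim (<⇒≢ i<p′ (≡-sym (injective (n<1+n p′) (m<n⇒m<1+n i<p′) e′)))
    ... | inj₂ e′ with m≤n⇒m<n∨m≡n i<p′
    ...   | inj₁ 1+i<p′ = ⊥-elim (walk-noReturn (suc i)
              (trans (≡-sym (cong (walk ∘ suc) (injective (n<1+n p′) (s≤s 1+i<p′) e′))) (≡-sym e)))
    ...   | inj₂ refl = ⊥-elim (adj-irreflexive G (walk-adjacent (suc i)) e)

    returns : walk p ≡ walk 0
    returns = repeats-start repeat

    returns′ : walk (suc p) ≡ walk 1
    returns′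
      with walk-interior p′ (walk 1) (subst (λ x → Adj G x (walk 1)) (≡-sym returns) (walk-adjacent 0))
    ... | inj₂ e = ≡-sym e
    ... | inj₁ e with injective 1<p (n<1+n p′) e
    ...   | refl = ⊥-elim (walk-noReturn 0 returns)

    neighbour-on-cycle : ∀ {t y} → t < p → Adj G (walk t) y →
                         Σ ℕ λ t′ → t′ < p × walk t′ ≡ y × CyclicallyAdjacent p t t′
    neighbour-on-cycle {zero} {y} _ ty
      with walk-interior p′ y (subst (λ x → Adj G x y) (≡-sym returns) ty)
    ... | inj₁ e = p′ , n<1+n p′ , ≡-sym e , inj₂ (inj₂ (inj₁ (refl , refl)))
    ... | inj₂ e = 1 , 1<p , trans (≡-sym returns′) (≡-sym e) , inj₁ refl
    neighbour-on-cycle {suc t} {y} t<p ty with walk-interior t y ty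
    ... | inj₁ e = t , <-trans (n<1+n t) t<p , ≡-sym e , inj₂ (inj₁ refl)
    ... | inj₂ e with m≤n⇒m<n∨m≡n t<p
    ...   | inj₁ 2+t<p = 2 + t , 2+t<p , ≡-sym e , inj₁ refl
    ...   | inj₂ 2+t≡p = 0 , s≤s z≤n , trans (≡-sym returns) (trans (cong walk (≡-sym 2+t≡p)) (≡-sym e)) ,
                         inj₂ (inj₂ (inj₂ (refl , 2+t≡p)))

    adjacent⇒cyclic : ∀ {a b} → a < p → b < p → Adj G (walk a) (walk b) → CyclicallyAdjacent p a b
    adjacent⇒cyclic a<p b<p ab with neighbour-on-cycle a<p ab
    ... | t , t<p , e , cyclic with injective t<p b<p e
    ...   | refl = cyclic

    cyclic⇒adjacent : ∀ {a b} → CyclicallyAdjacent p a b → Adj G (walk a) (walk b)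
    cyclic⇒adjacent {a} {b} (inj₁ refl)                      = walk-adjacent a
    cyclic⇒adjacent {a} {b} (inj₂ (inj₁ refl))               = adj-sym G (walk-adjacent b)
    cyclic⇒adjacent {a} {b} (inj₂ (inj₂ (inj₁ (refl , e)))) =
      adj-sym G (subst (Adj G (walk b)) (trans (cong walk e) returns) (walk-adjacent b))
    cyclic⇒adjacent {a} {b} (inj₂ (inj₂ (inj₂ (refl , e)))) =
      subst (Adj G (walk a)) (trans (cong walk e) returns) (walk-adjacent a)

    on-cycle : ∀ v → Σ ℕ λ t → t < p × walk t ≡ v
    on-cycle v = spread (connected F.zero v) (0 , s≤s z≤n , refl)
      where
      spread : ∀ {u v} → Reachable G u v → Σ ℕ (λ t → t < p × walk t ≡ u) → Σ ℕ λ t → t < p × walk t ≡ v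
      spread here          found            = found
      spread (step ux rest) (t , t<p , refl) with neighbour-on-cycle t<p ux
      ... | t′ , t′<p , e , _ = spread rest (t′ , t′<p , e)

    index : Fin (suc m) → ℕ
    index v = proj₁ (on-cycle v)

    index<p : ∀ v → index v < p
    index<p v = proj₁ (proj₂ (on-cycle v))

    walk-index : ∀ v → walk (index v) ≡ v
    walk-index v = proj₂ (proj₂ (on-cycle v))

    index-injective : ∀ {u v} → index u ≡ index v → u ≡ v
    index-injective {u} {v} e = trans (≡-sym (walk-index u)) (trans (cong walk e) (walk-index v))

    adjacent⇔cyclic : ∀ u v → Adj G u v ⇔ CyclicallyAdjacent p (index u) (index v)
    adjacent⇔cyclic u v = mk⇔
      (adjacent⇒cyclic (index<p u) (index<p v)
         ∘ subst₂ (Adj G) (≡-sym (walk-index u)) (≡-sym (walk-index v)))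
      (subst₂ (Adj G) (walk-index u) (walk-index v) ∘ cyclic⇒adjacent)

    p≡n : p ≡ suc m
    p≡n = ≤-antisym (≮⇒≥ n≮p) (≮⇒≥ p≮n)
      where
      n≮p : ¬ suc m < p
      n≮p n<p with i , j , i<j , e ← pigeonhole n<p (walk ∘ F.toℕ) =
        <⇒≢ i<j (injective (toℕ<n i) (toℕ<n j) e)
      p≮n : ¬ p < suc m
      p≮n p<n with u , v , u<v , e ← pigeonhole p<n (λ v → F.fromℕ< (index<p v)) =
        Finₚ.<⇒≢ u<v (index-injective
          (trans (≡-sym (toℕ-fromℕ< (index<p u))) (trans (cong F.toℕ e) (toℕ-fromℕ< (index<p v)))))

    σ : Fin (suc m) → Fin (suc m)
    σ v = F.fromℕ< (subst (index v <_) p≡n (index<p v))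

    toℕ-σ : ∀ v → F.toℕ (σ v) ≡ index v
    toℕ-σ v = toℕ-fromℕ< (subst (index v <_) p≡n (index<p v))

    isCycle : IsCycle G
    isCycle = σ , (σ-injective , σ-surjective) , λ u v →
      subst (Adj G u v ⇔_) (cong₂ (λ N i → CyclicallyAdjacent N i (F.toℕ (σ v))) p≡n (≡-sym (toℕ-σ u)))
        (subst (λ j → Adj G u v ⇔ CyclicallyAdjacent p (index u) j) (≡-sym (toℕ-σ v)) (adjacent⇔cyclic u v))
      where
      σ-injective : ∀ {u v} → σ u ≡ σ v → u ≡ v
      σ-injective {u} {v} e = index-injective (trans (≡-sym (toℕ-σ u)) (trans (cong F.toℕ e) (toℕ-σ v)))
      σ-surjective : ∀ i → ∃ λ v → ∀ {z} → z ≡ v → σ z ≡ i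
      σ-surjective i = walk (F.toℕ i) , λ { refl → toℕ-injective (trans (toℕ-σ _)
        (injective (index<p _) (subst (F.toℕ i <_) (≡-sym p≡n) (toℕ<n i)) (walk-index _))) }

  isCycle : IsCycle G
  isCycle with first-repeat
  ... | zero   , (_ , () , _) , _
  ... | suc p′ , repeat , before = FirstReturn.isCycle p′ repeat before

record RestrictsToHomomorphism {n} {G : SimpleGraph n} {k} (f : SubV G k → SubV G k) : Set where
  field
    restriction          : Fin n → Fin n
    orig-restriction     : ∀ v → f (orig v) ≡ orig (restriction v)
    restriction-adjacent : ∀ {a c} → Adj G a c → Adj G (restriction a) (restriction c)

module _ {n} {G : SimpleGraph n} {k : ℕ} where

  orig-injective : ∀ {a b} → orig {G = G} {k = k} a ≡ orig b → a ≡ b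
  orig-injective refl = refl

  subAdj-sym : Symmetric (SubAdj G k)
  subAdj-sym {orig a}        {orig b}        (k≡1 , ab)        = k≡1 , adj-sym G ab
  subAdj-sym {orig _}        {mid _ _ _ _ _} r                 = r
  subAdj-sym {mid _ _ _ _ _} {orig _}        r                 = r
  subAdj-sym {mid _ _ _ _ _} {mid _ _ _ _ _} (refl , refl , ±1) = refl , refl , swap ±1

  mid-cong : ∀ {u v u′ v′} {p : u F.< v} {q : Adj G u v} {p′ : u′ F.< v′} {q′ : Adj G u′ v′}
               {j j′ : Fin (k ∸ 1)} → u ≡ u′ → v ≡ v′ → F.toℕ j ≡ F.toℕ j′ →
             mid {G = G} {k = k} u v p q j ≡ mid u′ v′ p′ q′ j′
  mid-cong {p = p} {q} {p′} {q′} refl refl e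
    rewrite <-irrelevant p p′ | adj-irrelevant G q q′ | toℕ-injective e = refl

  restriction-isAutomorphism :
    (∀ {f} → IsAutomorphism (SubAdj G k) f → RestrictsToHomomorphism f) →
    ∀ {f} → IsAutomorphism (SubAdj G k) f →
    Σ (Fin n → Fin n) λ g → (∀ v → f (orig v) ≡ orig (g v)) × IsAutomorphism (Adj G) g
  restriction-isAutomorphism restricts {f} aut =
    g , g-orig , (g-injective , g-surjective) , λ a c →
      mk⇔ g-adjacent (subst₂ (Adj G) (h-g a) (h-g c) ∘ h-adjacent)
    where
    open Automorphism aut
    open RestrictsToHomomorphism (restricts aut)
      renaming (restriction to g; orig-restriction to g-orig; restriction-adjacent to g-adjacent)
    open RestrictsToHomomorphism (restricts inverse-isAutomorphism)
      renaming (restriction to h; orig-restriction to h-orig; restriction-adjacent to h-adjacent)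
    h-g : ∀ a → h (g a) ≡ a
    h-g a = orig-injective
      (trans (≡-sym (h-orig (g a))) (trans (cong inverse (≡-sym (g-orig a))) (inverse-f (orig a))))
    g-h : ∀ a → g (h a) ≡ a
    g-h a = orig-injective
      (trans (≡-sym (g-orig (h a))) (trans (cong f (≡-sym (h-orig a))) (f-inverse (orig a))))
    g-injective : ∀ {a c} → g a ≡ g c → a ≡ c
    g-injective {a} {c} e = trans (≡-sym (h-g a)) (trans (cong h e) (h-g c))
    g-surjective : ∀ a → ∃ λ v → ∀ {z} → z ≡ v → g z ≡ a
    g-surjective a = h a , λ { refl → g-h a }

unsubdivided-restricts : ∀ {n} {G : SimpleGraph n} {f} → IsAutomorphism (SubAdj G 1) f →
                         RestrictsToHomomorphism f
unsubdivided-restricts {G = G} {f} aut = record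
  { restriction          = original ∘ f ∘ orig
  ; orig-restriction     = λ v → orig-original (f (orig v))
  ; restriction-adjacent = λ {a} {c} ac →
      proj₂ (subst₂ (SubAdj G 1) (orig-original (f (orig a))) (orig-original (f (orig c)))
                    (preserves (refl , ac)))
  }
  where
  open Automorphism aut
  original : SubV G 1 → Fin _
  original (orig v) = v
  orig-original : ∀ x → x ≡ orig (original x)
  orig-original (orig v) = refl

module Subdivision {n} (G : SimpleGraph n) (k′ : ℕ) where

  k : ℕ
  k = 2 + k′

  V : Set
  V = SubV G k

  R : V → V → Set
  R = SubAdj G k

  open Walks R

  module Chain {u v} (u<v : u F.< v) (uv : Adj G u v) where

    chain : ℕ → V
    chain zero = orig u
    chain (suc i) with i <? suc k′
    ... | yes i<k-1 = mid u v u<v uv (F.fromℕ< i<k-1)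
    ... | no _      = orig v

    chain-mid : ∀ {i} (i<k-1 : i < suc k′) → chain (suc i) ≡ mid u v u<v uv (F.fromℕ< i<k-1)
    chain-mid {i} i<k-1 with i <? suc k′
    ... | yes _    = refl
    ... | no i≮k-1 = ⊥-elim (i≮k-1 i<k-1)

    chain-end : chain k ≡ orig v
    chain-end with suc k′ <? suc k′
    ... | yes k-1<k-1 = ⊥-elim (<-irrefl refl k-1<k-1)
    ... | no _        = refl

    mid≡chain : ∀ {p : u F.< v} {q : Adj G u v} j → mid u v p q j ≡ chain (suc (F.toℕ j))
    mid≡chain j = ≡-sym (trans (chain-mid (toℕ<n j)) (mid-cong refl refl (toℕ-fromℕ< (toℕ<n j))))

    position : V → ℕ
    position (orig x) with x F.≟ u
    ... | yes _ = 0
    ... | no _  = k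
    position (mid _ _ _ _ j) = suc (F.toℕ j)

    position-chain : ∀ i → i ≤ k → position (chain i) ≡ i
    position-chain zero _ with u F.≟ u
    ... | yes _  = refl
    ... | no u≢u = ⊥-elim (u≢u refl)
    position-chain (suc i) i<k with i <? suc k′
    ... | yes i<k-1 = cong suc (toℕ-fromℕ< i<k-1)
    ... | no i≮k-1 with v F.≟ u
    ...   | yes v≡u = ⊥-elim (Finₚ.<-irrefl (≡-sym v≡u) u<v)
    ...   | no _    = ≡-sym (≤-antisym i<k (s≤s (≮⇒≥ i≮k-1)))

    chain-adjacent : ∀ i → i < k → R (chain i) (chain (suc i))
    chain-adjacent zero _ = inj₁ (refl , refl)
    chain-adjacent (suc i) (s≤s i<k-1) with i <? suc k′
    ... | no i≮k-1 = ⊥-elim (i≮k-1 i<k-1)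
    ... | yes i<k-1′ with suc i <? suc k′
    ...   | yes i+1<k-1 =
      refl , refl , inj₁ (trans (cong suc (toℕ-fromℕ< i<k-1′)) (≡-sym (toℕ-fromℕ< i+1<k-1)))
    ...   | no i+1≮k-1 =
      inj₂ (refl , cong (2 +_) (trans (toℕ-fromℕ< i<k-1′) (≤-antisym (≤-pred i<k-1) (≤-pred (≮⇒≥ i+1≮k-1)))))

    mid-neighbours : ∀ {p q j y} → R (mid u v p q j) y → y ≡ chain (F.toℕ j) ⊎ y ≡ chain (2 + F.toℕ j)
    mid-neighbours {y = orig _} (inj₁ (refl , j≡0))   = inj₁ (cong chain (≡-sym j≡0))
    mid-neighbours {y = orig _} (inj₂ (refl , 2+j≡k)) =
      inj₂ (trans (≡-sym chain-end) (cong chain (≡-sym 2+j≡k)))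
    mid-neighbours {y = mid _ _ _ _ j′} (refl , refl , inj₁ 1+j≡j′) =
      inj₂ (trans (mid≡chain j′) (cong (chain ∘ suc) (≡-sym 1+j≡j′)))
    mid-neighbours {y = mid _ _ _ _ j′} (refl , refl , inj₂ 1+j′≡j) =
      inj₁ (trans (mid≡chain j′) (cong chain 1+j′≡j))

    chain-thread : IsThread chain k
    chain-thread = record
      { isNonBacktrackingWalk = record { adjacent = chain-adjacent ; noReturn = noReturn }
      ; interior              = interior
      }
      where
      noReturn : ∀ i → 2 + i ≤ k → chain (2 + i) ≢ chain i
      noReturn i le e = <⇒≢ (m<n+m i (s≤s z≤n))
        (trans (≡-sym (position-chain i (m+n≤o⇒n≤o 2 le)))
               (trans (cong position (≡-sym e)) (position-chain (2 + i) le)))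
      interior : ∀ i y → 2 + i ≤ k → R (chain (suc i)) y → y ≡ chain i ⊎ y ≡ chain (2 + i)
      interior i y (s≤s i<k-1) r rewrite chain-mid i<k-1 with mid-neighbours r
      ... | neighbours rewrite toℕ-fromℕ< i<k-1 = neighbours

  record Route (c d : Fin n) : Set where
    field
      vertex   : ℕ → V
      isThread : IsThread vertex k
      start    : vertex 0 ≡ orig c
      end      : vertex k ≡ orig d
    open IsThread isThread public

  chain-route : ∀ {c d} → c F.< d → Adj G c d → Route c d
  chain-route c<d cd = record { vertex = chain ; isThread = chain-thread ; start = refl ; end = chain-end }
    where open Chain c<d cd

  reverse-route : ∀ {c d} → Route c d → Route d c
  reverse-route r = record
    { vertex   = λ i → vertex (k ∸ i)
    ; isThread = reverse-thread subAdj-sym isThread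
    ; start    = end
    ; end      = trans (cong vertex (n∸n≡0 k)) start
    }
    where open Route r

  route : ∀ {c d} → Adj G c d → Route c d
  route {c} {d} cd with Finₚ.<-cmp c d
  ... | tri< c<d _ _ = chain-route c<d cd
  ... | tri≈ _ c≡d _ = ⊥-elim (adj-irreflexive G cd c≡d)
  ... | tri> _ _ d<c = reverse-route (chain-route d<c (adj-sym G cd))

  route-first-adjacent : ∀ {c d} (r : Route c d) → R (orig c) (Route.vertex r 1)
  route-first-adjacent r = subst (λ x → R x (vertex 1)) start (adjacent 0 (s≤s z≤n))
    where open Route r

  neighbour-on-route : ∀ {c y} → R (orig c) y →
                       Σ (Fin n) λ d → Σ (Adj G c d) λ cd → y ≡ Route.vertex (route cd) 1
  neighbour-on-route {y = orig _} (() , _)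
  neighbour-on-route {c} {mid _ v c<v cv j} (inj₁ (refl , j≡0)) = v , cv , first-step
    where
    first-step : mid c v c<v cv j ≡ Route.vertex (route cv) 1
    first-step with Finₚ.<-cmp c v
    ... | tri< c<v′ _ _ = trans (Chain.mid≡chain c<v′ cv j) (cong (Chain.chain c<v′ cv ∘ suc) j≡0)
    ... | tri≈ _ c≡v _ = ⊥-elim (adj-irreflexive G cv c≡v)
    ... | tri> _ _ v<c = ⊥-elim (Finₚ.<-asym c<v v<c)
  neighbour-on-route {c} {mid u _ u<c uc j} (inj₂ (refl , 2+j≡k)) = u , adj-sym G uc , first-step
    where
    first-step : mid u c u<c uc j ≡ Route.vertex (route (adj-sym G uc)) 1
    first-step with Finₚ.<-cmp c u
    ... | tri< c<u _ _  = ⊥-elim (Finₚ.<-asym u<c c<u)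
    ... | tri≈ _ c≡u _  = ⊥-elim (adj-irreflexive G uc (≡-sym c≡u))
    ... | tri> _ _ u<c′ = trans (Chain.mid≡chain u<c′ _ j)
                               (cong (Chain.chain u<c′ _ ∘ suc) (suc-injective (suc-injective 2+j≡k)))

  walk-ends-at-neighbour : ∀ {W c} → IsNonBacktrackingWalk W k → W 0 ≡ orig c →
                           Σ (Fin n) λ d → Adj G c d × W k ≡ orig d
  walk-ends-at-neighbour {W} walk W₀
    with d , cd , W₁ ← neighbour-on-route
                         (subst (λ x → R x (W 1)) W₀ (IsNonBacktrackingWalk.adjacent walk 0 (s≤s z≤n)))
    = d , cd , trans (follows-thread isThread walk (trans W₀ (≡-sym start)) W₁ k ≤-refl) end
    where open Route (route cd)

  route-first-step-injective : ∀ {c d d′} (r : Route c d) (r′ : Route c d′) →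
                               Route.vertex r 1 ≡ Route.vertex r′ 1 → d ≡ d′
  route-first-step-injective r r′ same-first = orig-injective
    (trans (≡-sym R.end) (trans (follows-thread R′.isThread R.isNonBacktrackingWalk
                                   (trans R.start (≡-sym R′.start)) same-first k ≤-refl) R′.end))
    where module R = Route r
          module R′ = Route r′

  mid-hasTwoNeighbours : ∀ {u v p q j} → HasTwoNeighbours (mid u v p q j)
  mid-hasTwoNeighbours {p = p} {q} {j} rewrite Chain.mid≡chain p q {p} {q} j =
    thread-hasTwoNeighbours subAdj-sym (Chain.chain-thread p q) (F.toℕ j) (s≤s (toℕ<n j))

  orig-hasTwoNeighbours : ∀ {b} → HasTwoNeighbours (orig b) → Walks.HasTwoNeighbours (Adj G) b
  orig-hasTwoNeighbours {b} (y′ , z′ , y′≢z′ , by′ , bz′ , only)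
    with y , by , y′≡ ← neighbour-on-route by′
       | z , bz , z′≡ ← neighbour-on-route bz′
    = y , z , y≢z , by , bz , λ w bw →
        ⊎-map (λ e → route-first-step-injective (route bw) (route by) (trans e y′≡))
              (λ e → route-first-step-injective (route bw) (route bz) (trans e z′≡))
              (only (Route.vertex (route bw) 1) (route-first-adjacent (route bw)))
    where
    y≢z : y ≢ z
    y≢z refl = y′≢z′ (trans y′≡ (trans (cong (λ by → Route.vertex (route by) 1) (adj-irrelevant G by bz))
                                        (≡-sym z′≡)))

  module _ {f : V → V} (aut : IsAutomorphism R f) where
    open Automorphism aut

    edge-image : ∀ {a c a′} → f (orig a) ≡ orig a′ → Adj G a c →
                 Σ (Fin n) λ c′ → Adj G a′ c′ × f (orig c) ≡ orig c′
    edge-image {a} {c} fa ac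
      with c′ , a′c′ , fc ← walk-ends-at-neighbour
                              (map-nonBacktrackingWalk (Route.isNonBacktrackingWalk (route ac)))
                              (trans (cong f (Route.start (route ac))) fa)
      = c′ , a′c′ , trans (cong f (≡-sym (Route.end (route ac)))) fc

    orig-image : ∀ {b} → ¬ Walks.HasTwoNeighbours (Adj G) b → Σ (Fin n) λ d → f (orig b) ≡ orig d
    orig-image {b} not-two with f (orig b) in fb
    ... | orig d        = d , refl
    ... | mid u v p q j = ⊥-elim (not-two (orig-hasTwoNeighbours (map⁻¹-hasTwoNeighbours aut
                            (subst HasTwoNeighbours (≡-sym fb) mid-hasTwoNeighbours))))

    restricts : Connected G → ∀ {b} → ¬ Walks.HasTwoNeighbours (Adj G) b → RestrictsToHomomorphism f
    restricts connected {b} not-two = record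
      { restriction          = proj₁ ∘ image
      ; orig-restriction     = proj₂ ∘ image
      ; restriction-adjacent = λ {a} {c} ac →
          let c′ , a′c′ , fc = edge-image (proj₂ (image a)) ac
          in subst (Adj G _) (orig-injective (trans (≡-sym fc) (proj₂ (image c)))) a′c′
      }
      where
      spread : ∀ {u v} → Reachable G u v → Σ (Fin n) (λ d → f (orig u) ≡ orig d) →
               Σ (Fin n) λ d → f (orig v) ≡ orig d
      spread here           found    = found
      spread (step uw rest) (_ , fu) with d , _ , fw ← edge-image fu uw = spread rest (d , fw)
      image : ∀ v → Σ (Fin n) λ d → f (orig v) ≡ orig d
      image v = spread (connected b v) (orig-image not-two)

lemma3p1 : (n : ℕ) → (G : SimpleGraph n) → 3 ≤ n → Connected G → ¬ IsCycle G →
    (k : ℕ) → 1 ≤ k →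
    (f : SubV G k → SubV G k) → IsAutomorphism (SubAdj G k) f →
    Σ (Fin n → Fin n) λ g →
    (∀ v → f (orig v) ≡ orig (g v)) × IsAutomorphism (Adj G) g
lemma3p1 n G _ _ _ zero () f aut
lemma3p1 n G _ _ _ (suc zero) _ f aut = restriction-isAutomorphism unsubdivided-restricts aut
lemma3p1 (suc m) G (s≤s _) connected not-cycle (suc (suc k′)) _ f aut with all? (hasTwoNeighbours? G)
... | yes two          = ⊥-elim (not-cycle (TwoRegular.isCycle G connected two))
... | no not-all-two
  with b , not-two ← ¬∀⟶∃¬ _ _ (hasTwoNeighbours? G) not-all-two
  = restriction-isAutomorphism (λ aut → Subdivision.restricts G k′ aut connected not-two) aut
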